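{- Let $G$ be a graph isomorphic to a daisy cube of order $h$, with a proper embedding $\alpha$ such that $\alpha(v^0)=0^h$, and let $\widehat X\subseteq V(G)$ be the corresponding set of maximal vertices (the vertices whose labels are maximal elements of $(\alpha(V(G)),\le)$). Let $v\in\bigcap_{x\in\widehat X} I_G(v^0,x)$ and let $\tau:B^h\to B^h$ be $\tau(w)=w\oplus\alpha(v)$ (i.e. $\tau_{(i)}(w)=w_i$ if $\alpha(v)_i=0$ and $\tau_{(i)}(w)=1-w_i$ if $\alpha(v)_i=1$). Then (i) the restriction of $\tau$ to $\alpha(V(G))$ is a bijection from $\alpha(V(G))$ onto $\alpha(V(G))$; (ii) $\tau\circ\alpha$ is a proper embedding of $G$ whose minimal vertex is $v$ (i.e. $\tau(\alpha(v))=0^h$) and whose set of maximal vertices is $Y=\{y\in V(G): \tau(\alpha(y))=\alpha(x)\text{ for some }x\in\widehat X\}$.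
   Context: $B=\{0,1\}$, $B^h$ binary words of length $h$, $Q_h$ the hypercube on $B^h$ (adjacent iff Hamming distance $1$), $\oplus$ bitwise XOR. $u\le v$ means $u_i\le v_i$ for all $i$. For $X\subseteq B^h$ the daisy cube $Q_h(X)$ is the subgraph of $Q_h$ induced by $\{v:v\le x\text{ for some }x\in X\}$; a graph isomorphic to one is a daisy cube of order $h$. An isometric embedding $\alpha:V(G)\to B^h$ preserves distances (graph distance = Hamming distance); it is proper if $G$ is isomorphic to $Q_h(\alpha(V(G)))$. For a proper embedding $\alpha$, the vertex with label $0^h$ is the minimal vertex with respect to $\alpha$, and the set of maximal vertices with respect to $\alpha$ is the set of vertices whose labels are maximal in $(\alpha(V(G)),\le)$. $I_G(a,b)$ is the set of vertices on shortest $a,b$-paths in $G$. -}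

module Defs where

open import Data.Nat using (ℕ; zero; suc; _+_; _≤_)
open import Data.Bool using (Bool; true; false; _xor_; if_then_else_)
import Data.Bool as B
open import Data.Fin using (Fin)
open import Data.Vec using (Vec; []; _∷_; zipWith; replicate)
open import Data.Vec.Relation.Binary.Pointwise.Inductive using (Pointwise)
open import Data.Product using (Σ; ∃; _×_; _,_)
open import Relation.Binary.PropositionalEquality using (_≡_)
open import Relation.Nullary using (¬_)
open import Level using (Level; suc; _⊔_; 0ℓ)

record Graph : Set₁ where
  field
    n       : ℕ
    Adj     : Fin n → Fin n → Set
    symm    : ∀ {u v} → Adj u v → Adj v u
    irrefl  : ∀ {u} → ¬ Adj u u

module _ (G : Graph) where
  open Graph G

  V : Set
  V = Fin n

  data Walk : V → V → ℕ → Set where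
    here : ∀ {u} → Walk u u 0
    step : ∀ {u w v k} → Adj u w → Walk w v k → Walk u v (ℕ.suc k)

  data OnWalk (x : V) : ∀ {u v k} → Walk u v k → Set where
    at-start : ∀ {u v k} (p : Walk u v k) → x ≡ u → OnWalk x p
    later    : ∀ {u w v k} (a : Adj u w) (p : Walk w v k) → OnWalk x p → OnWalk x (step a p)

  Dist : V → V → ℕ → Set
  Dist u v k = Walk u v k × (∀ m → Walk u v m → k ≤ m)

  InInterval : V → V → V → Set
  InInterval a b x = Σ ℕ λ k → Dist a b k × Σ (Walk a b k) λ p → OnWalk x p

Word : ℕ → Set
Word h = Vec Bool h

ham : ∀ {h} → Word h → Word h → ℕ
ham [] [] = 0
ham (a ∷ as) (b ∷ bs) = (if a xor b then 1 else 0) + ham as bs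

_≼_ : ∀ {h} → Word h → Word h → Set
_≼_ = Pointwise B._≤_

_⊕_ : ∀ {h} → Word h → Word h → Word h
_⊕_ = zipWith _xor_

zeros : ∀ h → Word h
zeros h = replicate h false

module _ (G : Graph) {h : ℕ} where
  open Graph G

  Isometric : (V G → Word h) → Set
  Isometric α = ∀ u v → Dist G u v (ham (α u) (α v))

  -- G is isomorphic to the daisy cube Q_h(X), X ⊆ B^h given as a predicate:
  -- there is a bijection f from V(G) onto {w : w ≤ x for some x ∈ X}
  -- with u ~ v iff f u, f v at Hamming distance 1.
  IsoDaisy : (Word h → Set) → Set
  IsoDaisy X = Σ (V G → Word h) λ f →
      (∀ u → ∃ λ x → X x × (f u ≼ x))
    × (∀ u v → f u ≡ f v → u ≡ v)
    × (∀ w → (∃ λ x → X x × (w ≼ x)) → ∃ λ u → f u ≡ w)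
    × (∀ u v → (Adj u v → ham (f u) (f v) ≡ 1) × (ham (f u) (f v) ≡ 1 → Adj u v))

  IsDaisyCube : Set₁
  IsDaisyCube = Σ (Word h → Set) λ X → IsoDaisy X

  InImage : (V G → Word h) → Word h → Set
  InImage α w = ∃ λ u → α u ≡ w

  Proper : (V G → Word h) → Set
  Proper α = Isometric α × IsoDaisy (InImage α)

  IsMaximal : (V G → Word h) → V G → Set
  IsMaximal α x = ∀ y → α x ≼ α y → α y ≡ α x

-- Every label α u lies below a maximal label α x, and v lies on a geodesic
-- from v⁰ (label 0ʰ) to x, so α v ≼ α x as well; hence α u ⊕ α v ≼ α x.
-- The image of a proper embedding is closed downwards (it has as many
-- elements as its down-closure), so τ maps α(V(G)) into itself, and being
-- an involution it is a bijection of α(V(G)). Translation by α v preserves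
-- Hamming distance, while the daisy condition and maximality only depend on
-- the image, which τ ∘ α shares with α.
module Submission where

open import Defs
open import Data.Nat using (ℕ; zero; suc; _+_; _≤_; _<_; z≤n; s≤s; s≤s⁻¹)
import Data.Nat.Properties as ℕ
open import Data.Bool using (true; false; _xor_; if_then_else_)
import Data.Bool as Bool
open import Data.Bool.Properties using (xor-same; xor-assoc; xor-identityʳ; ≤-minimum)
import Data.Bool.Properties as Bool
open import Data.Fin using (Fin; punchOut)
import Data.Fin.Properties as Fin
open import Data.Vec using ([]; _∷_)
open import Data.Vec.Properties using (zipWith-assoc; zipWith-identityʳ; ≡-dec)
open import Data.Vec.Relation.Binary.Pointwise.Inductive as Pointwise using ([]; _∷_)
open import Data.Product using (∃; _×_; _,_; proj₁; proj₂; map₁; map₂)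
open import Function using (_∘_)
open import Function.Definitions using (Injective)
open import Relation.Nullary using (Dec; yes; no; contradiction)
open import Relation.Nullary.Decidable using (_×-dec_; ¬?)
open import Relation.Binary.PropositionalEquality
  using (_≡_; _≢_; refl; sym; trans; cong; cong₂; subst; subst₂; module ≡-Reasoning)

private
  variable
    h : ℕ

weight : Word h → ℕ
weight {h} = ham (zeros h)

ham-same : (a : Word h) → ham a a ≡ 0
ham-same []          = refl
ham-same (false ∷ a) = ham-same a
ham-same (true ∷ a)  = ham-same a

ham-⊕ʳ : (a b c : Word h) → ham (a ⊕ c) (b ⊕ c) ≡ ham a b
ham-⊕ʳ []      []      []      = refl
ham-⊕ʳ (x ∷ a) (y ∷ b) (z ∷ c) = cong₂ _+_ (bit x y z) (ham-⊕ʳ a b c)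
  where
  bit : ∀ x y z → (if (x xor z) xor (y xor z) then 1 else 0) ≡ (if x xor y then 1 else 0)
  bit false false false = refl
  bit false false true  = refl
  bit false true  false = refl
  bit false true  true  = refl
  bit true  false false = refl
  bit true  false true  = refl
  bit true  true  false = refl
  bit true  true  true  = refl

⊕-same : (a : Word h) → a ⊕ a ≡ zeros h
⊕-same []      = refl
⊕-same (x ∷ a) = cong₂ _∷_ (xor-same x) (⊕-same a)

⊕-cancelʳ : (a c : Word h) → (a ⊕ c) ⊕ c ≡ a
⊕-cancelʳ a c = begin
  (a ⊕ c) ⊕ c   ≡⟨ zipWith-assoc xor-assoc a c c ⟩
  a ⊕ (c ⊕ c)   ≡⟨ cong (a ⊕_) (⊕-same c) ⟩
  a ⊕ zeros _   ≡⟨ zipWith-identityʳ xor-identityʳ a ⟩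
  a             ∎
  where open ≡-Reasoning

≼-refl : {a : Word h} → a ≼ a
≼-refl = Pointwise.refl Bool.≤-refl

≼-trans : {a b c : Word h} → a ≼ b → b ≼ c → a ≼ c
≼-trans = Pointwise.trans Bool.≤-trans

⊕-≼ : {a c m : Word h} → a ≼ m → c ≼ m → (a ⊕ c) ≼ m
⊕-≼ []       []       = []
⊕-≼ (p ∷ ps) (q ∷ qs) = bit p q ∷ ⊕-≼ ps qs
  where
  bit : ∀ {x z y} → x Bool.≤ y → z Bool.≤ y → (x xor z) Bool.≤ y
  bit {false} {false} _ _   = ≤-minimum _
  bit {true}  {true}  _ _   = ≤-minimum _
  bit {false} {true}  _ q   = q
  bit {true}  {false} p _   = p

weight≤length : (a : Word h) → weight a ≤ h
weight≤length []          = z≤n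
weight≤length (false ∷ a) = ℕ.m≤n⇒m≤1+n (weight≤length a)
weight≤length (true ∷ a)  = s≤s (weight≤length a)

weight-mono : {a b : Word h} → a ≼ b → weight a ≤ weight b
weight-mono []                                 = z≤n
weight-mono {a = false ∷ _} {false ∷ _} (_ ∷ p) = weight-mono p
weight-mono {a = false ∷ _} {true ∷ _}  (_ ∷ p) = ℕ.m≤n⇒m≤1+n (weight-mono p)
weight-mono {a = true ∷ _}  {true ∷ _}  (_ ∷ p) = s≤s (weight-mono p)
weight-mono {a = true ∷ _}  {false ∷ _} (() ∷ _)

weight-strictMono : {a b : Word h} → a ≼ b → a ≢ b → weight a < weight b
weight-strictMono []      a≢b = contradiction refl a≢b
weight-strictMono {a = false ∷ _} {false ∷ _} (_ ∷ p) a≢b = weight-strictMono p (a≢b ∘ cong (false ∷_))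
weight-strictMono {a = true ∷ _}  {true ∷ _}  (_ ∷ p) a≢b = s≤s (weight-strictMono p (a≢b ∘ cong (true ∷_)))
weight-strictMono {a = false ∷ _} {true ∷ _}  (_ ∷ p) _   = s≤s (weight-mono p)
weight-strictMono {a = true ∷ _}  {false ∷ _} (() ∷ _) _

weight-triangle : (a b : Word h) → weight b ≤ weight a + ham a b
weight-triangle []          []          = z≤n
weight-triangle (false ∷ a) (false ∷ b) = weight-triangle a b
weight-triangle (false ∷ a) (true ∷ b)  =
  subst (suc (weight b) ≤_) (sym (ℕ.+-suc (weight a) (ham a b))) (s≤s (weight-triangle a b))
weight-triangle (true ∷ a)  (false ∷ b) =
  ℕ.m≤n⇒m≤1+n (ℕ.≤-trans (weight-triangle a b) (ℕ.+-monoʳ-≤ (weight a) (ℕ.n≤1+n _)))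
weight-triangle (true ∷ a)  (true ∷ b)  = s≤s (weight-triangle a b)

geodesic⇒≼ : (a b : Word h) → weight a + ham a b ≤ weight b → a ≼ b
geodesic⇒≼ []          []          _        = []
geodesic⇒≼ (false ∷ a) (false ∷ b) p        = Bool.b≤b ∷ geodesic⇒≼ a b p
geodesic⇒≼ (false ∷ a) (true ∷ b)  p        =
  Bool.f≤t ∷ geodesic⇒≼ a b (s≤s⁻¹ (subst (_≤ suc (weight b)) (ℕ.+-suc (weight a) (ham a b)) p))
geodesic⇒≼ (true ∷ a)  (true ∷ b)  (s≤s p) = Bool.b≤b ∷ geodesic⇒≼ a b p
geodesic⇒≼ (true ∷ a)  (false ∷ b) p        = contradiction (weight-triangle a b) (ℕ.<⇒≱ a+ab<b)
  where
  a+ab<b : weight a + ham a b < weight b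
  a+ab<b = subst (_≤ weight b) (ℕ.+-suc (weight a) (ham a b)) (ℕ.≤-trans (ℕ.n≤1+n _) p)

module _ (G : Graph) where

  walk₀⇒≡ : ∀ {u v} → Walk G u v 0 → u ≡ v
  walk₀⇒≡ here = refl

  Dist-unique : ∀ {u v k k′} → Dist G u v k → Dist G u v k′ → k ≡ k′
  Dist-unique (p , p-min) (q , q-min) = ℕ.≤-antisym (p-min _ q) (q-min _ p)

  splitAt : ∀ {x u v k} (p : Walk G u v k) → OnWalk G x p →
            ∃ λ k₁ → ∃ λ k₂ → Walk G u x k₁ × Walk G x v k₂ × k₁ + k₂ ≡ k
  splitAt {k = k} p (at-start .p refl) = 0 , k , here , p , refl
  splitAt (step e p) (later .e .p x∈p) with splitAt p x∈p
  ... | k₁ , k₂ , p₁ , p₂ , k₁+k₂≡k = suc k₁ , k₂ , step e p₁ , p₂ , cong suc k₁+k₂≡k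

  interval⇒geodesic : ∀ {a b x k k₁ k₂} → InInterval G a b x →
                      Dist G a b k → Dist G a x k₁ → Dist G x b k₂ → k₁ + k₂ ≤ k
  interval⇒geodesic (k′ , d′ , p , x∈p) d (_ , ax-min) (_ , xb-min)
    with splitAt p x∈p
  ... | m₁ , m₂ , p₁ , p₂ , m₁+m₂≡k′ =
    subst (_ ≤_) (trans m₁+m₂≡k′ (Dist-unique d′ d)) (ℕ.+-mono-≤ (ax-min m₁ p₁) (xb-min m₂ p₂))

module _ (G : Graph) {α : V G → Word h} (iso : Isometric G α) where

  Isometric⇒injective : Injective _≡_ _≡_ α
  Isometric⇒injective {u} {v} αu≡αv =
    walk₀⇒≡ G (subst (Walk G u v) (trans (cong (ham (α u)) (sym αu≡αv)) (ham-same (α u))) (proj₁ (iso u v)))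

  interval⇒≼ : ∀ {a b x} → α a ≡ zeros h → InInterval G a b x → α x ≼ α b
  interval⇒≼ {a} {b} {x} αa≡0 x∈I = geodesic⇒≼ (α x) (α b)
    (subst (λ z → ham z (α x) + ham (α x) (α b) ≤ ham z (α b)) αa≡0
           (interval⇒geodesic G x∈I (iso a b) (iso a x) (iso x b)))

  ⊕ʳ-isometric : ∀ c → Isometric G (λ u → α u ⊕ c)
  ⊕ʳ-isometric c u v = subst (Dist G u v) (sym (ham-⊕ʳ (α u) (α v) c)) (iso u v)

injective⇒surjective : ∀ {n} (φ : Fin n → Fin n) → Injective _≡_ _≡_ φ → ∀ t → ∃ λ s → φ s ≡ t
injective⇒surjective {suc n} φ φ-inj t with Fin.any? (λ s → φ s Fin.≟ t)
... | yes hit  = hit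
... | no miss =
  let i , j , i<j , same = Fin.pigeonhole (ℕ.n<1+n n) (λ s → punchOut (t≢φ s))
  in contradiction (φ-inj (Fin.punchOut-injective (t≢φ i) (t≢φ j) same)) (Fin.<⇒≢ i<j)
  where
  t≢φ : ∀ s → t ≢ φ s
  t≢φ s t≡φs = miss (s , sym t≡φs)

module _ (G : Graph) (α : V G → Word h) where

  maximal-above : ∀ u → ∃ λ x → IsMaximal G α x × α u ≼ α x
  maximal-above u = climb h u (ℕ.m≤m+n h _)
    where
    _≼?_ : (a b : Word h) → Dec (a ≼ b)
    _≼?_ = Pointwise.decidable Bool._≤?_

    _≟_ : (a b : Word h) → Dec (a ≡ b)
    _≟_ = ≡-dec Bool._≟_

    -- k bounds the remaining steps up: each one raises the weight, which never exceeds h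
    climb : ∀ k u → h ≤ k + weight (α u) → ∃ λ x → IsMaximal G α x × α u ≼ α x
    climb k u bound with Fin.any? (λ y → (α u ≼? α y) ×-dec ¬? (α y ≟ α u))
    ... | no nothing-above = u , u-max , ≼-refl
      where
      u-max : IsMaximal G α u
      u-max y αu≼αy with α y ≟ α u
      ... | yes αy≡αu = αy≡αu
      ... | no αy≢αu  = contradiction (y , αu≼αy , αy≢αu) nothing-above
    climb zero u bound | yes (y , αu≼αy , αy≢αu) = contradiction
      (ℕ.≤-trans (ℕ.≤-trans (s≤s bound) (weight-strictMono αu≼αy (αy≢αu ∘ sym))) (weight≤length (α y)))
      (ℕ.n≮n h)
    climb (suc k) u bound | yes (y , αu≼αy , αy≢αu) =
      map₂ (map₂ (≼-trans αu≼αy)) (climb k y (ℕ.≤-trans bound weight-grows))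
      where
      weight-grows : suc k + weight (α u) ≤ k + weight (α y)
      weight-grows = subst (_≤ k + weight (α y)) (ℕ.+-suc k _) (ℕ.+-monoʳ-≤ k (weight-strictMono αu≼αy (αy≢αu ∘ sym)))

module _ (G : Graph) where

  -- g = f⁻¹ ∘ α is an injective, hence onto, self-map of V G, so f and α have the same image.
  image-downClosed : {α : V G → Word h} → Injective _≡_ _≡_ α → IsoDaisy G (InImage G α) →
                     ∀ {w u} → w ≼ α u → InImage G α w
  image-downClosed {α = α} α-inj (f , _ , _ , f-onto , _) {w} {u} w≼αu =
    let u₀ , fu₀≡w = f-onto w (α u , (u , refl) , w≼αu)
        u₁ , gu₁≡u₀ = injective⇒surjective g g-inj u₀
    in u₁ , (begin
      α u₁      ≡⟨ sym (f∘g u₁) ⟩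
      f (g u₁)  ≡⟨ cong f gu₁≡u₀ ⟩
      f u₀      ≡⟨ fu₀≡w ⟩
      w         ∎)
    where
    open ≡-Reasoning

    preimage : ∀ u → ∃ λ u′ → f u′ ≡ α u
    preimage u = f-onto (α u) (α u , (u , refl) , ≼-refl)

    g : V G → V G
    g u = proj₁ (preimage u)

    f∘g : ∀ u → f (g u) ≡ α u
    f∘g u = proj₂ (preimage u)

    g-inj : Injective _≡_ _≡_ g
    g-inj {u} {v} gu≡gv = α-inj (trans (sym (f∘g u)) (trans (cong f gu≡gv) (f∘g v)))

  IsoDaisy-resp : {X Y : Word h → Set} → (∀ {w} → X w → Y w) → (∀ {w} → Y w → X w) →
                  IsoDaisy G X → IsoDaisy G Y
  IsoDaisy-resp X⊆Y Y⊆X (f , below , f-inj , f-onto , adjacency) =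
    f , map₂ (map₁ X⊆Y) ∘ below , f-inj , (λ w → f-onto w ∘ map₂ (map₁ Y⊆X)) , adjacency

  IsMaximal-transfer : {α β : V G → Word h} → (∀ {w} → InImage G β w → InImage G α w) →
                       ∀ {x y} → β y ≡ α x → IsMaximal G α x → IsMaximal G β y
  IsMaximal-transfer {α = α} {β} β⊆α {x} {y} βy≡αx x-max z βy≼βz =
    let z′ , αz′≡βz = β⊆α (z , refl) in begin
      β z   ≡⟨ sym αz′≡βz ⟩
      α z′  ≡⟨ x-max z′ (subst₂ _≼_ βy≡αx (sym αz′≡βz) βy≼βz) ⟩
      α x   ≡⟨ sym βy≡αx ⟩
      β y   ∎
    where open ≡-Reasoning

module Translation (G : Graph) {α : V G → Word h}
                   (iso : Isometric G α) (daisy : IsoDaisy G (InImage G α))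
                   {v⁰ v : V G} (αv⁰≡0 : α v⁰ ≡ zeros h)
                   (v-below-maxima : ∀ x → IsMaximal G α x → InInterval G v⁰ x v) where

  τ : Word h → Word h
  τ w = w ⊕ α v

  τ-involutive : ∀ w → τ (τ w) ≡ w
  τ-involutive w = ⊕-cancelʳ w (α v)

  τ-injective : ∀ {w w′} → τ w ≡ τ w′ → w ≡ w′
  τ-injective {w} {w′} τw≡τw′ = trans (sym (τ-involutive w)) (trans (cong τ τw≡τw′) (τ-involutive w′))

  τ-closed : ∀ {w} → InImage G α w → InImage G α (τ w)
  τ-closed (u , refl) =
    let x , x-max , αu≼αx = maximal-above G α u
        αv≼αx = interval⇒≼ G iso αv⁰≡0 (v-below-maxima x x-max)
    in image-downClosed G (Isometric⇒injective G iso) daisy (⊕-≼ αu≼αx αv≼αx)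

  β : V G → Word h
  β u = τ (α u)

  image-β⊆α : ∀ {w} → InImage G β w → InImage G α w
  image-β⊆α (u , refl) = τ-closed (u , refl)

  image-α⊆β : ∀ {w} → InImage G α w → InImage G β w
  image-α⊆β (u , refl) =
    let u′ , αu′≡βu = τ-closed (u , refl) in u′ , trans (cong τ αu′≡βu) (τ-involutive (α u))

  β-maximal⇒ : ∀ {y} → IsMaximal G β y → ∃ λ x → IsMaximal G α x × β y ≡ α x
  β-maximal⇒ {y} y-max =
    let x , αx≡βy = image-β⊆α (y , refl)
    in x , IsMaximal-transfer G image-α⊆β αx≡βy y-max , sym αx≡βy

  ⇒β-maximal : ∀ {y} → (∃ λ x → IsMaximal G α x × β y ≡ α x) → IsMaximal G β y
  ⇒β-maximal (x , x-max , βy≡αx) = IsMaximal-transfer G image-β⊆α βy≡αx x-max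

lemma2 : (G : Graph) (h : ℕ) → IsDaisyCube G {h}
    → (α : V G → Word h) → Proper G α
    → (v⁰ : V G) → α v⁰ ≡ zeros h
    → (v : V G) → (∀ x → IsMaximal G α x → InInterval G v⁰ x v)
    → let τ = λ (w : Word h) → w ⊕ α v in
      -- (i) τ restricted to α(V(G)) is a bijection onto α(V(G))
      ((∀ w → InImage G α w → InImage G α (τ w))
      × (∀ w w′ → InImage G α w → InImage G α w′ → τ w ≡ τ w′ → w ≡ w′)
      × (∀ w′ → InImage G α w′ → ∃ λ w → InImage G α w × τ w ≡ w′))
      -- (ii) τ ∘ α is a proper embedding, with minimal vertex v and maximal vertices Y
      × Proper G (λ u → τ (α u))
      × τ (α v) ≡ zeros h
      × (∀ y → (IsMaximal G (λ u → τ (α u)) y → ∃ λ x → IsMaximal G α x × τ (α y) ≡ α x)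
             × ((∃ λ x → IsMaximal G α x × τ (α y) ≡ α x) → IsMaximal G (λ u → τ (α u)) y))
lemma2 G h _ α (iso , daisy) v⁰ αv⁰≡0 v v-below-maxima =
  ( (λ _ → τ-closed)
  , (λ _ _ _ _ → τ-injective)
  , (λ w′ w′∈α → τ w′ , τ-closed w′∈α , τ-involutive w′) )
  , (⊕ʳ-isometric G {α = α} iso (α v) , IsoDaisy-resp G image-α⊆β image-β⊆α daisy)
  , ⊕-same (α v)
  , λ _ → β-maximal⇒ , ⇒β-maximal
  where open Translation G iso daisy αv⁰≡0 v-below-maxima
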